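{- Let $d,s\in\mathbb{F}_q[t]$ with $d\ne0$, and let $f_1,\dots,f_L\in\mathbb{F}_q[t][u]$ with $\deg f_1<\dots<\deg f_L$. Then there exist polynomials $g_1,\dots,g_L\in\mathbb{F}_q[t][u]$ (depending on $d$ and $s$) and an $L\times L$ matrix $\mathcal{A}$ with entries in $\mathbb{F}_q[t]$ such that: (1) $\mathcal{A}\,(f_1(du+s),\dots,f_L(du+s))^T=(g_1(u),\dots,g_L(u))^T$; (2) $\mathcal{A}$ is lower triangular, all its diagonal entries are equal to a constant $c\in\mathbb{F}_q[t]$ depending only on $f_1,\dots,f_L$, and every entry of $\mathcal{A}$ depends at most on $s$ and $f_1,\dots,f_L$ (not on $d$); (3) $[g_i]_{\deg g_j}=0$ whenever $i\ne j$; moreover $\deg g_j=\deg f_j$ and $[g_j]_{\deg g_j}=c\,d^{\deg f_j}[f_j]_{\deg f_j}$ for all $1\le j\le L$.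
   Context: $\mathbb{F}_q$ is the finite field with $q$ elements. For a polynomial $f(u)$, $[f]_i$ denotes the coefficient of $u^i$ in $f$. -}

module Defs where

open import Level using (Level; 0ℓ)
open import Data.Nat using (ℕ; zero; suc; _<_)
open import Data.Fin using (Fin; toℕ)
open import Data.List using (List; []; _∷_; map)
open import Data.Maybe using (Maybe; just; nothing)
open import Data.Product using (Σ; _×_; ∃)
open import Data.Unit using (⊤)
open import Data.Empty using (⊥)
open import Relation.Nullary using (¬_)
open import Relation.Binary using (Decidable)
open import Algebra.Bundles using (CommutativeRing)
open import Algebra.Bundles.Raw using (RawRing)

record FiniteField : Set₁ where
  field
    commutativeRing : CommutativeRing 0ℓ 0ℓ
  open CommutativeRing commutativeRing public
  field
    _⁻¹       : Carrier → Carrier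
    0≉1       : ¬ (0# ≈ 1#)
    inverseʳ  : ∀ x → ¬ (x ≈ 0#) → x * (x ⁻¹) ≈ 1#
    _≟_       : Decidable _≈_
    size      : ℕ
    enum      : Fin size → Carrier
    enum-surj : ∀ x → Σ (Fin size) (λ i → enum i ≈ x)

-- Univariate polynomials over a (raw) ring, as coefficient lists
-- (constant coefficient first).  Equality is coefficientwise.

module Poly (R : RawRing 0ℓ 0ℓ) where
  open RawRing R

  P : Set
  P = List Carrier

  coeff : P → ℕ → Carrier
  coeff []      _       = 0#
  coeff (a ∷ p) zero    = a
  coeff (a ∷ p) (suc i) = coeff p i

  _≈ₚ_ : P → P → Set
  p ≈ₚ q = ∀ i → coeff p i ≈ coeff q i

  _+ₚ_ : P → P → P
  []      +ₚ q       = q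
  (a ∷ p) +ₚ []      = a ∷ p
  (a ∷ p) +ₚ (b ∷ q) = (a + b) ∷ (p +ₚ q)

  -ₚ_ : P → P
  -ₚ p = map -_ p

  _*ₚ_ : P → P → P
  []      *ₚ q = []
  (a ∷ p) *ₚ q = map (a *_) q +ₚ (0# ∷ (p *ₚ q))

  0ₚ : P
  0ₚ = []

  1ₚ : P
  1ₚ = 1# ∷ []

  const : Carrier → P
  const a = a ∷ []

  _∘ₚ_ : P → P → P
  []      ∘ₚ h = []
  (a ∷ p) ∘ₚ h = const a +ₚ (h *ₚ (p ∘ₚ h))

  rawRing : RawRing 0ℓ 0ℓ
  rawRing = record
    { Carrier = P ; _≈_ = _≈ₚ_ ; _+_ = _+ₚ_ ; _*_ = _*ₚ_
    ; -_ = -ₚ_ ; 0# = 0ₚ ; 1# = 1ₚ }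

  -- Degree, with deg 0 = -∞ encoded as nothing.
  HasDeg : P → Maybe ℕ → Set
  HasDeg p nothing  = ∀ i → coeff p i ≈ 0#
  HasDeg p (just n) = ¬ (coeff p n ≈ 0#) × (∀ m → n < m → coeff p m ≈ 0#)

  coeffᵐ : P → Maybe ℕ → Carrier
  coeffᵐ p nothing  = 0#
  coeffᵐ p (just n) = coeff p n

module RingHelpers (R : RawRing 0ℓ 0ℓ) where
  open RawRing R

  _^_ : Carrier → ℕ → Carrier
  x ^ zero  = 1#
  x ^ suc n = x * (x ^ n)

  -- x ^ deg, where the power by -∞ is only ever multiplied by the
  -- coefficient at -∞ (which is 0); we set it to 1.
  _^ᵐ_ : Carrier → Maybe ℕ → Carrier
  x ^ᵐ nothing = 1#
  x ^ᵐ just n  = x ^ n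

  sumFin : (L : ℕ) → (Fin L → Carrier) → Carrier
  sumFin zero    v = 0#
  sumFin (suc L) v = v Fin.zero + sumFin L (λ j → v (Fin.suc j))

_<ᵐ_ : Maybe ℕ → Maybe ℕ → Set
nothing <ᵐ nothing = ⊥
nothing <ᵐ just _  = ⊤
just _  <ᵐ nothing = ⊥
just m  <ᵐ just n  = m < n

module Rings (F : FiniteField) where
  open FiniteField F using (rawRing)

  module Pt = Poly rawRing
  Fqt : RawRing 0ℓ 0ℓ
  Fqt = Pt.rawRing

  module Pu = Poly Fqt
  Fqtu : RawRing 0ℓ 0ℓ
  Fqtu = Pu.rawRing

  module HA = RingHelpers Fqt
  module HB = RingHelpers Fqtu

-- Let e k n be the n-th coefficient of f_k(u + s).  Since [f_k(du + s)]_n = d^n e k n, the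
-- n-th coefficient of Σ_k A_ik f_k(du + s) is d^n Σ_k A_ik e k n, so it suffices to find A,
-- independent of d, with Σ_k A_ik e k (δ j) = 0 for i ≠ j.  Translation by s preserves degree
-- and leading coefficient, so the matrix (e k (δ j)) is triangular with the leading
-- coefficients a_j on its diagonal.  Fraction-free Gaussian elimination diagonalises it: row i
-- starts as the i-th unit vector and, for j = L-1, …, 0, is multiplied by a_j and, when j < i,
-- corrected by the multiple of the j-th unit vector that kills its value at δ j; zeros at
-- δ j' for j' > j survive because e j (δ j') = 0.  Entries right of the diagonal are never
-- touched, and the diagonal becomes c = Π_j a_j.  This works over any integral domain, and
-- F_q[t] is one.

module Submission where

open import Defs
open import Level using (0ℓ; _⊔_)
open import Algebra.Bundles using (CommutativeRing; AbelianGroup; CommutativeMonoid)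
open import Data.List using ([]; _∷_; map)
open import Data.Vec.Functional using (removeAt)
open import Data.Nat as ℕ using (ℕ; zero; suc; _<_; _≤_; z≤n; s≤s)
import Data.Nat.Properties as ℕ
open import Data.Fin as Fin using (Fin; toℕ; fromℕ<)
import Data.Fin.Properties as Fin
open import Data.Maybe using (Maybe; just; nothing)
open import Data.Product using (Σ; _,_; _×_; ∃; proj₁; proj₂)
open import Data.Sum using (_⊎_; inj₁; inj₂)
open import Data.Unit using (tt)
open import Relation.Nullary using (¬_; Dec; yes; no; contradiction)
open import Relation.Binary using (Setoid; IsEquivalence; Decidable; tri<; tri≈; tri>)
open import Relation.Binary.PropositionalEquality as ≡ using (_≡_; _≢_)
import Relation.Binary.Reasoning.Setoid as SetoidReasoning

module PolynomialRing (R : CommutativeRing 0ℓ 0ℓ) where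
  open CommutativeRing R
  open Poly rawRing renaming (rawRing to rawRingₚ)
  open RingHelpers rawRingₚ using (sumFin)
  open import Algebra.Properties.Semiring.Sum semiring using (sum-syntax)
  open import Algebra.Properties.Ring ring using (-0#≈0#)

  coeff-+ₚ : ∀ p q i → coeff (p +ₚ q) i ≈ coeff p i + coeff q i
  coeff-+ₚ []      q       i       = sym (+-identityˡ _)
  coeff-+ₚ (a ∷ p) []      i       = sym (+-identityʳ _)
  coeff-+ₚ (a ∷ p) (b ∷ q) zero    = refl
  coeff-+ₚ (a ∷ p) (b ∷ q) (suc i) = coeff-+ₚ p q i

  coeff-scale : ∀ a p i → coeff (map (a *_) p) i ≈ a * coeff p i
  coeff-scale a []      i       = sym (zeroʳ a)
  coeff-scale a (b ∷ p) zero    = refl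
  coeff-scale a (b ∷ p) (suc i) = coeff-scale a p i

  coeff-negₚ : ∀ p i → coeff (-ₚ p) i ≈ - coeff p i
  coeff-negₚ []      i       = sym -0#≈0#
  coeff-negₚ (a ∷ p) zero    = refl
  coeff-negₚ (a ∷ p) (suc i) = coeff-negₚ p i

  coeff-sumFin : ∀ n (v : Fin n → P) i → coeff (sumFin n v) i ≈ ∑[ k < n ] coeff (v k) i
  coeff-sumFin zero    v i = refl
  coeff-sumFin (suc n) v i =
    trans (coeff-+ₚ (v Fin.zero) _ i) (+-congˡ (coeff-sumFin n (λ k → v (Fin.suc k)) i))

  -- _≈ₚ_ unfolds to a Π-type, so Agda cannot recover p and q from a proof
  -- of p ≈ₚ q; the laws are proved for this injective wrapper instead.
  record _≋_ (p q : P) : Set where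
    constructor coeffwise
    field coeff-≈ : p ≈ₚ q
  open _≋_ public

  infix 4 _≋_

  ≋-isEquivalence : IsEquivalence _≋_
  ≋-isEquivalence = record
    { refl  = coeffwise λ _ → refl
    ; sym   = λ (coeffwise p≈q) → coeffwise λ i → sym (p≈q i)
    ; trans = λ (coeffwise p≈q) (coeffwise q≈r) → coeffwise λ i → trans (p≈q i) (q≈r i)
    }

  ≋-setoid : Setoid 0ℓ 0ℓ
  ≋-setoid = record { isEquivalence = ≋-isEquivalence }

  open IsEquivalence ≋-isEquivalence public
    using () renaming (refl to ≋-refl; sym to ≋-sym; trans to ≋-trans)

  ∷-cong : ∀ {a b p q} → a ≈ b → p ≋ q → (a ∷ p) ≋ (b ∷ q)
  ∷-cong a≈b (coeffwise p≈q) = coeffwise λ { zero → a≈b ; (suc i) → p≈q i }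

  0∷0ₚ : (0# ∷ 0ₚ) ≋ 0ₚ
  0∷0ₚ = coeffwise λ { zero → refl ; (suc i) → refl }

  +ₚ-cong : ∀ {p p' q q'} → p ≋ p' → q ≋ q' → (p +ₚ q) ≋ (p' +ₚ q')
  +ₚ-cong {p} {p'} {q} {q'} (coeffwise p≈p') (coeffwise q≈q') = coeffwise λ i →
    trans (coeff-+ₚ p q i) (trans (+-cong (p≈p' i) (q≈q' i)) (sym (coeff-+ₚ p' q' i)))

  +ₚ-assoc : ∀ p q r → ((p +ₚ q) +ₚ r) ≋ (p +ₚ (q +ₚ r))
  +ₚ-assoc p q r = coeffwise λ i → begin
    coeff ((p +ₚ q) +ₚ r) i              ≈⟨ trans (coeff-+ₚ (p +ₚ q) r i) (+-congʳ (coeff-+ₚ p q i)) ⟩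
    (coeff p i + coeff q i) + coeff r i  ≈⟨ +-assoc _ _ _ ⟩
    coeff p i + (coeff q i + coeff r i)  ≈⟨ trans (coeff-+ₚ p (q +ₚ r) i) (+-congˡ (coeff-+ₚ q r i)) ⟨
    coeff (p +ₚ (q +ₚ r)) i              ∎
    where open SetoidReasoning setoid

  +ₚ-comm : ∀ p q → (p +ₚ q) ≋ (q +ₚ p)
  +ₚ-comm p q = coeffwise λ i → trans (coeff-+ₚ p q i) (trans (+-comm _ _) (sym (coeff-+ₚ q p i)))

  +ₚ-identityʳ : ∀ p → (p +ₚ 0ₚ) ≋ p
  +ₚ-identityʳ p = coeffwise λ i → trans (coeff-+ₚ p [] i) (+-identityʳ _)

  -ₚ-cong : ∀ {p q} → p ≋ q → (-ₚ p) ≋ (-ₚ q)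
  -ₚ-cong {p} {q} (coeffwise p≈q) = coeffwise λ i →
    trans (coeff-negₚ p i) (trans (-‿cong (p≈q i)) (sym (coeff-negₚ q i)))

  -ₚ-inverseˡ : ∀ p → ((-ₚ p) +ₚ p) ≋ 0ₚ
  -ₚ-inverseˡ p = coeffwise λ i →
    trans (coeff-+ₚ (-ₚ p) p i) (trans (+-congʳ (coeff-negₚ p i)) (-‿inverseˡ _))

  -ₚ-inverseʳ : ∀ p → (p +ₚ (-ₚ p)) ≋ 0ₚ
  -ₚ-inverseʳ p = coeffwise λ i →
    trans (coeff-+ₚ p (-ₚ p) i) (trans (+-congˡ (coeff-negₚ p i)) (-‿inverseʳ _))

  +ₚ-abelianGroup : AbelianGroup 0ℓ 0ℓ
  +ₚ-abelianGroup = record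
    { _≈_ = _≋_ ; _∙_ = _+ₚ_ ; ε = 0ₚ ; _⁻¹ = -ₚ_
    ; isAbelianGroup = record
      { isGroup = record
        { isMonoid = record
          { isSemigroup = record
            { isMagma = record { isEquivalence = ≋-isEquivalence ; ∙-cong = +ₚ-cong }
            ; assoc   = +ₚ-assoc
            }
          ; identity = (λ p → ≋-refl) , +ₚ-identityʳ
          }
        ; inverse = -ₚ-inverseˡ , -ₚ-inverseʳ
        ; ⁻¹-cong = -ₚ-cong
        }
      ; comm = +ₚ-comm
      }
    }

  open import Algebra.Properties.CommutativeSemigroup (AbelianGroup.commutativeSemigroup +ₚ-abelianGroup)
    using () renaming (x∙yz≈y∙xz to +ₚ-leftComm; interchange to +ₚ-interchange)

  scale-cong : ∀ a {p q} → p ≋ q → map (a *_) p ≋ map (a *_) q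
  scale-cong a {p} {q} (coeffwise p≈q) = coeffwise λ i →
    trans (coeff-scale a p i) (trans (*-congˡ (p≈q i)) (sym (coeff-scale a q i)))

  scale-+ₚ : ∀ a p q → map (a *_) (p +ₚ q) ≋ (map (a *_) p +ₚ map (a *_) q)
  scale-+ₚ a p q = coeffwise λ i → begin
    coeff (map (a *_) (p +ₚ q)) i                   ≈⟨ trans (coeff-scale a (p +ₚ q) i) (*-congˡ (coeff-+ₚ p q i)) ⟩
    a * (coeff p i + coeff q i)                     ≈⟨ distribˡ a _ _ ⟩
    a * coeff p i + a * coeff q i                   ≈⟨ +-cong (coeff-scale a p i) (coeff-scale a q i) ⟨
    coeff (map (a *_) p) i + coeff (map (a *_) q) i ≈⟨ coeff-+ₚ (map (a *_) p) _ i ⟨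
    coeff (map (a *_) p +ₚ map (a *_) q) i          ∎
    where open SetoidReasoning setoid

  scale-scale : ∀ a b p → map ((a * b) *_) p ≋ map (a *_) (map (b *_) p)
  scale-scale a b p = coeffwise λ i → begin
    coeff (map ((a * b) *_) p) i          ≈⟨ coeff-scale (a * b) p i ⟩
    (a * b) * coeff p i                   ≈⟨ *-assoc a b _ ⟩
    a * (b * coeff p i)                   ≈⟨ trans (coeff-scale a (map (b *_) p) i) (*-congˡ (coeff-scale b p i)) ⟨
    coeff (map (a *_) (map (b *_) p)) i   ∎
    where open SetoidReasoning setoid

  scale-zero : ∀ p → map (0# *_) p ≋ 0ₚ
  scale-zero p = coeffwise λ i → trans (coeff-scale 0# p i) (zeroˡ _)

  scale-identity : ∀ p → map (1# *_) p ≋ p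
  scale-identity p = coeffwise λ i → trans (coeff-scale 1# p i) (*-identityˡ _)

  scale-shift : ∀ a p → map (a *_) (0# ∷ p) ≋ (0# ∷ map (a *_) p)
  scale-shift a p = ∷-cong (zeroʳ a) ≋-refl

  shift-+ₚ : ∀ p q → (0# ∷ (p +ₚ q)) ≋ ((0# ∷ p) +ₚ (0# ∷ q))
  shift-+ₚ p q = ∷-cong (sym (+-identityˡ 0#)) ≋-refl

  *ₚ-zeroʳ : ∀ p → (p *ₚ 0ₚ) ≋ 0ₚ
  *ₚ-zeroʳ []      = ≋-refl
  *ₚ-zeroʳ (a ∷ p) = ≋-trans (∷-cong refl (*ₚ-zeroʳ p)) 0∷0ₚ

  *ₚ-congˡ : ∀ p {q q'} → q ≋ q' → (p *ₚ q) ≋ (p *ₚ q')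
  *ₚ-congˡ []      q≋q' = ≋-refl
  *ₚ-congˡ (a ∷ p) q≋q' = +ₚ-cong (scale-cong a q≋q') (∷-cong refl (*ₚ-congˡ p q≋q'))

  *ₚ-∷ʳ : ∀ p b q → (p *ₚ (b ∷ q)) ≋ (map (b *_) p +ₚ (0# ∷ (p *ₚ q)))
  *ₚ-∷ʳ []      b q = ≋-sym 0∷0ₚ
  *ₚ-∷ʳ (a ∷ p) b q = ∷-cong (+-congʳ (*-comm a b)) (begin
    map (a *_) q +ₚ (p *ₚ (b ∷ q))
      ≈⟨ +ₚ-cong ≋-refl (*ₚ-∷ʳ p b q) ⟩
    map (a *_) q +ₚ (map (b *_) p +ₚ (0# ∷ (p *ₚ q)))
      ≈⟨ +ₚ-leftComm (map (a *_) q) (map (b *_) p) (0# ∷ (p *ₚ q)) ⟩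
    map (b *_) p +ₚ (map (a *_) q +ₚ (0# ∷ (p *ₚ q)))  ∎)
    where open SetoidReasoning ≋-setoid

  *ₚ-comm : ∀ p q → (p *ₚ q) ≋ (q *ₚ p)
  *ₚ-comm []      q = ≋-sym (*ₚ-zeroʳ q)
  *ₚ-comm (a ∷ p) q =
    ≋-trans (+ₚ-cong ≋-refl (∷-cong refl (*ₚ-comm p q))) (≋-sym (*ₚ-∷ʳ q a p))

  *ₚ-congʳ : ∀ {p p'} q → p ≋ p' → (p *ₚ q) ≋ (p' *ₚ q)
  *ₚ-congʳ {p} {p'} q p≋p' = ≋-trans (*ₚ-comm p q) (≋-trans (*ₚ-congˡ q p≋p') (*ₚ-comm q p'))

  *ₚ-distribˡ : ∀ p q r → (p *ₚ (q +ₚ r)) ≋ ((p *ₚ q) +ₚ (p *ₚ r))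
  *ₚ-distribˡ []      q r = ≋-refl
  *ₚ-distribˡ (a ∷ p) q r = begin
    map (a *_) (q +ₚ r) +ₚ (0# ∷ (p *ₚ (q +ₚ r)))
      ≈⟨ +ₚ-cong (scale-+ₚ a q r)
                 (≋-trans (∷-cong refl (*ₚ-distribˡ p q r)) (shift-+ₚ (p *ₚ q) (p *ₚ r))) ⟩
    (map (a *_) q +ₚ map (a *_) r) +ₚ ((0# ∷ (p *ₚ q)) +ₚ (0# ∷ (p *ₚ r)))
      ≈⟨ +ₚ-interchange (map (a *_) q) (map (a *_) r) (0# ∷ (p *ₚ q)) (0# ∷ (p *ₚ r)) ⟩
    (map (a *_) q +ₚ (0# ∷ (p *ₚ q))) +ₚ (map (a *_) r +ₚ (0# ∷ (p *ₚ r)))  ∎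
    where open SetoidReasoning ≋-setoid

  *ₚ-distribʳ : ∀ r p q → ((p +ₚ q) *ₚ r) ≋ ((p *ₚ r) +ₚ (q *ₚ r))
  *ₚ-distribʳ r p q = begin
    (p +ₚ q) *ₚ r          ≈⟨ *ₚ-comm (p +ₚ q) r ⟩
    r *ₚ (p +ₚ q)          ≈⟨ *ₚ-distribˡ r p q ⟩
    (r *ₚ p) +ₚ (r *ₚ q)   ≈⟨ +ₚ-cong (*ₚ-comm r p) (*ₚ-comm r q) ⟩
    (p *ₚ r) +ₚ (q *ₚ r)   ∎
    where open SetoidReasoning ≋-setoid

  scale-*ₚ : ∀ a q r → (map (a *_) q *ₚ r) ≋ map (a *_) (q *ₚ r)
  scale-*ₚ a []      r = ≋-refl
  scale-*ₚ a (b ∷ q) r = begin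
    map ((a * b) *_) r +ₚ (0# ∷ (map (a *_) q *ₚ r))
      ≈⟨ +ₚ-cong (scale-scale a b r) (∷-cong refl (scale-*ₚ a q r)) ⟩
    map (a *_) (map (b *_) r) +ₚ (0# ∷ map (a *_) (q *ₚ r))
      ≈⟨ +ₚ-cong ≋-refl (scale-shift a (q *ₚ r)) ⟨
    map (a *_) (map (b *_) r) +ₚ map (a *_) (0# ∷ (q *ₚ r))
      ≈⟨ scale-+ₚ a (map (b *_) r) (0# ∷ (q *ₚ r)) ⟨
    map (a *_) (map (b *_) r +ₚ (0# ∷ (q *ₚ r)))  ∎
    where open SetoidReasoning ≋-setoid

  shift-*ₚ : ∀ p r → ((0# ∷ p) *ₚ r) ≋ (0# ∷ (p *ₚ r))
  shift-*ₚ p r = +ₚ-cong (scale-zero r) ≋-refl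

  *ₚ-assoc : ∀ p q r → ((p *ₚ q) *ₚ r) ≋ (p *ₚ (q *ₚ r))
  *ₚ-assoc []      q r = ≋-refl
  *ₚ-assoc (a ∷ p) q r = begin
    (map (a *_) q +ₚ (0# ∷ (p *ₚ q))) *ₚ r
      ≈⟨ *ₚ-distribʳ r (map (a *_) q) (0# ∷ (p *ₚ q)) ⟩
    (map (a *_) q *ₚ r) +ₚ ((0# ∷ (p *ₚ q)) *ₚ r)
      ≈⟨ +ₚ-cong (scale-*ₚ a q r) (≋-trans (shift-*ₚ (p *ₚ q) r) (∷-cong refl (*ₚ-assoc p q r))) ⟩
    map (a *_) (q *ₚ r) +ₚ (0# ∷ (p *ₚ (q *ₚ r)))  ∎
    where open SetoidReasoning ≋-setoid

  *ₚ-identityˡ : ∀ p → (1ₚ *ₚ p) ≋ p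
  *ₚ-identityˡ p = ≋-trans (+ₚ-cong (scale-identity p) 0∷0ₚ) (+ₚ-identityʳ p)

  *ₚ-identityʳ : ∀ p → (p *ₚ 1ₚ) ≋ p
  *ₚ-identityʳ p = ≋-trans (*ₚ-comm p 1ₚ) (*ₚ-identityˡ p)

  commutativeRing : CommutativeRing 0ℓ 0ℓ
  commutativeRing = record
    { Carrier = P ; _≈_ = _≈ₚ_ ; _+_ = _+ₚ_ ; _*_ = _*ₚ_ ; -_ = -ₚ_ ; 0# = 0ₚ ; 1# = 1ₚ
    ; isCommutativeRing = record
      { isRing = record
        { +-isAbelianGroup = record
          { isGroup = record
            { isMonoid = record
              { isSemigroup = record
                { isMagma = record
                  { isEquivalence = record
                    { refl  = λ _ → refl
                    ; sym   = λ {p} {q} p≈q → coeff-≈ (≋-sym (coeffwise {p} {q} p≈q))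
                    ; trans = λ {p} {q} {r} p≈q q≈r →
                                coeff-≈ (≋-trans (coeffwise {p} {q} p≈q) (coeffwise {q} {r} q≈r))
                    }
                  ; ∙-cong = λ {p} {p'} {q} {q'} p≈p' q≈q' →
                               coeff-≈ (+ₚ-cong (coeffwise {p} {p'} p≈p') (coeffwise {q} {q'} q≈q'))
                  }
                ; assoc = λ p q r → coeff-≈ (+ₚ-assoc p q r)
                }
              ; identity = (λ p _ → refl) , (λ p → coeff-≈ (+ₚ-identityʳ p))
              }
            ; inverse = (λ p → coeff-≈ (-ₚ-inverseˡ p)) , (λ p → coeff-≈ (-ₚ-inverseʳ p))
            ; ⁻¹-cong = λ {p} {q} p≈q → coeff-≈ (-ₚ-cong (coeffwise {p} {q} p≈q))
            }
          ; comm = λ p q → coeff-≈ (+ₚ-comm p q)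
          }
        ; *-cong     = λ {p} {p'} {q} {q'} p≈p' q≈q' →
                         coeff-≈ (≋-trans (*ₚ-congʳ q (coeffwise {p} {p'} p≈p'))
                                          (*ₚ-congˡ p' (coeffwise {q} {q'} q≈q')))
        ; *-assoc    = λ p q r → coeff-≈ (*ₚ-assoc p q r)
        ; *-identity = (λ p → coeff-≈ (*ₚ-identityˡ p)) , (λ p → coeff-≈ (*ₚ-identityʳ p))
        ; distrib    = (λ p q r → coeff-≈ (*ₚ-distribˡ p q r)) , (λ r p q → coeff-≈ (*ₚ-distribʳ r p q))
        }
      ; *-comm = λ p q → coeff-≈ (*ₚ-comm p q)
      }
    }

record IsDomain {c ℓ} (R : CommutativeRing c ℓ) : Set (c ⊔ ℓ) where
  open CommutativeRing R
  field
    1≉0            : ¬ 1# ≈ 0#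
    noZeroDivisors : ∀ {x y} → ¬ x ≈ 0# → ¬ y ≈ 0# → ¬ x * y ≈ 0#

module PolynomialDegree (R : CommutativeRing 0ℓ 0ℓ) where
  open CommutativeRing R
  open Poly rawRing hiding (rawRing)
  open PolynomialRing R

  DegreeAtMost : P → ℕ → Set
  DegreeAtMost p n = ∀ m → n < m → coeff p m ≈ 0#

  coeff-∷-*ₚ-zero : ∀ a p q → coeff ((a ∷ p) *ₚ q) 0 ≈ a * coeff q 0
  coeff-∷-*ₚ-zero a p q = trans (coeff-+ₚ (map (a *_) q) (0# ∷ (p *ₚ q)) 0)
    (trans (+-congʳ (coeff-scale a q 0)) (+-identityʳ _))

  coeff-∷-*ₚ-suc : ∀ a p q i → coeff ((a ∷ p) *ₚ q) (suc i) ≈ a * coeff q (suc i) + coeff (p *ₚ q) i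
  coeff-∷-*ₚ-suc a p q i =
    trans (coeff-+ₚ (map (a *_) q) (0# ∷ (p *ₚ q)) (suc i)) (+-congʳ (coeff-scale a q (suc i)))

  *ₚ-degree : ∀ p q {m n} → DegreeAtMost p m → DegreeAtMost q n →
              DegreeAtMost (p *ₚ q) (m ℕ.+ n) × coeff (p *ₚ q) (m ℕ.+ n) ≈ coeff p m * coeff q n
  *ₚ-degree []      q             p≤m q≤n = (λ _ _ → refl) , sym (zeroˡ _)
  *ₚ-degree (a ∷ p) q {zero}  {n} p≤0 q≤n = bound , coeff-scaled n
    where
    p*q≋0 : (p *ₚ q) ≋ 0ₚ
    p*q≋0 = *ₚ-congʳ q (coeffwise {p} {0ₚ} λ i → p≤0 (suc i) (s≤s z≤n))
    coeff-scaled : ∀ k → coeff ((a ∷ p) *ₚ q) k ≈ a * coeff q k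
    coeff-scaled k = trans (coeff-+ₚ (map (a *_) q) (0# ∷ (p *ₚ q)) k)
      (trans (+-cong (coeff-scale a q k) (coeff-≈ (≋-trans (∷-cong refl p*q≋0) 0∷0ₚ) k)) (+-identityʳ _))
    bound : DegreeAtMost ((a ∷ p) *ₚ q) n
    bound k n<k = trans (coeff-scaled k) (trans (*-congˡ (q≤n k n<k)) (zeroʳ a))
  *ₚ-degree (a ∷ p) q {suc m} {n} p≤m q≤n = bound , top
    where
    IH = *ₚ-degree p q (λ k m<k → p≤m (suc k) (s≤s m<k)) q≤n
    n≤m+n = ℕ.m≤n+m n m
    bound : DegreeAtMost ((a ∷ p) *ₚ q) (suc m ℕ.+ n)
    bound (suc k) (s≤s m+n<k) = trans (coeff-∷-*ₚ-suc a p q k)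
      (trans (+-cong (trans (*-congˡ (q≤n (suc k) (ℕ.m<n⇒m<1+n (ℕ.≤-<-trans n≤m+n m+n<k)))) (zeroʳ a))
                     (proj₁ IH k m+n<k))
             (+-identityˡ 0#))
    top = trans (coeff-∷-*ₚ-suc a p q (m ℕ.+ n))
      (trans (+-cong (trans (*-congˡ (q≤n (suc (m ℕ.+ n)) (s≤s n≤m+n))) (zeroʳ a)) (proj₂ IH))
             (+-identityˡ _))

  zero⊎hasDegree : Decidable _≈_ → ∀ p → p ≈ₚ 0ₚ ⊎ ∃ λ n → HasDeg p (just n)
  zero⊎hasDegree _≟_ []      = inj₁ λ _ → refl
  zero⊎hasDegree _≟_ (a ∷ p) with zero⊎hasDegree _≟_ p | a ≟ 0#
  ... | inj₂ (n , p[n]≉0 , p≤n) | _     = inj₂ (suc n , p[n]≉0 , λ { (suc k) (s≤s n<k) → p≤n k n<k })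
  ... | inj₁ p≈0               | yes a≈0 = inj₁ λ { zero → a≈0 ; (suc i) → p≈0 i }
  ... | inj₁ p≈0               | no  a≉0 = inj₂ (0 , a≉0 , λ { (suc k) _ → p≈0 k })

  -- The zero polynomial gets leading coefficient 1, so that a product of leading
  -- coefficients of polynomials over a domain stays nonzero.
  leadingCoeff : P → Maybe ℕ → Carrier
  leadingCoeff p nothing  = 1#
  leadingCoeff p (just n) = coeff p n

  coeffᵐ≈leadingCoeff : ∀ p x → coeffᵐ p x ≈ leadingCoeff p x ⊎ x ≡ nothing
  coeffᵐ≈leadingCoeff p nothing  = inj₂ ≡.refl
  coeffᵐ≈leadingCoeff p (just n) = inj₁ refl

  isDomain : Decidable _≈_ → IsDomain R → IsDomain commutativeRing
  isDomain _≟_ domain = record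
    { 1≉0            = λ 1≈0 → 1≉0 (1≈0 0)
    ; noZeroDivisors = λ {p} {q} → noZeroDivisorsₚ p q
    }
    where
    open IsDomain domain
    noZeroDivisorsₚ : ∀ p q → ¬ p ≈ₚ 0ₚ → ¬ q ≈ₚ 0ₚ → ¬ (p *ₚ q) ≈ₚ 0ₚ
    noZeroDivisorsₚ p q p≉0 q≉0 pq≈0 with zero⊎hasDegree _≟_ p | zero⊎hasDegree _≟_ q
    ... | inj₁ p≈0 | _        = p≉0 p≈0
    ... | inj₂ _   | inj₁ q≈0 = q≉0 q≈0
    ... | inj₂ (m , p[m]≉0 , p≤m) | inj₂ (n , q[n]≉0 , q≤n) =
      noZeroDivisors p[m]≉0 q[n]≉0 (trans (sym (proj₂ (*ₚ-degree p q p≤m q≤n))) (pq≈0 (m ℕ.+ n)))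

module PolynomialsOverDomain (R : CommutativeRing 0ℓ 0ℓ) (domain : IsDomain R) where
  open CommutativeRing R
  open IsDomain domain
  open Poly rawRing hiding (rawRing)
  open RingHelpers rawRing using (_^ᵐ_)
  open PolynomialDegree R using (leadingCoeff)

  ^ᵐ-nonzero : ∀ {x} n → ¬ x ≈ 0# → ¬ x ^ᵐ n ≈ 0#
  ^ᵐ-nonzero nothing        x≉0 = 1≉0
  ^ᵐ-nonzero (just zero)    x≉0 = 1≉0
  ^ᵐ-nonzero (just (suc n)) x≉0 = noZeroDivisors x≉0 (^ᵐ-nonzero (just n) x≉0)

  leadingCoeff-nonzero : ∀ {p} x → HasDeg p x → ¬ leadingCoeff p x ≈ 0#
  leadingCoeff-nonzero nothing  _            = 1≉0
  leadingCoeff-nonzero (just n) (p[n]≉0 , _) = p[n]≉0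

  hasDeg-fromLeading : ∀ {p q u} x → HasDeg p x → ¬ u ≈ 0# → coeffᵐ q x ≈ u * coeffᵐ p x →
                       (∀ m → x <ᵐ just m → coeff q m ≈ 0#) → HasDeg q x
  hasDeg-fromLeading nothing  _            _   _          above = λ m → above m tt
  hasDeg-fromLeading (just n) (p[n]≉0 , _) u≉0 q[n]≈u*p[n] above =
    (λ q[n]≈0 → noZeroDivisors u≉0 p[n]≉0 (trans (sym q[n]≈u*p[n]) q[n]≈0)) , above

module AffineSubstitution (R : CommutativeRing 0ℓ 0ℓ) where
  open CommutativeRing R
  open Poly rawRing hiding (rawRing)
  open RingHelpers rawRing using (_^_)
  open PolynomialRing R
  open PolynomialDegree R
  open import Algebra.Properties.CommutativeSemigroup *-commutativeSemigroup
    using () renaming (x∙yz≈y∙xz to *-leftComm)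
  open SetoidReasoning setoid

  affine : Carrier → Carrier → P
  affine s d = s ∷ d ∷ []

  coeff-const-*ₚ : ∀ a p i → coeff (const a *ₚ p) i ≈ a * coeff p i
  coeff-const-*ₚ a p i = trans (coeff-+ₚ (map (a *_) p) (0# ∷ []) i)
    (trans (+-cong (coeff-scale a p i) (coeff-≈ 0∷0ₚ i)) (+-identityʳ _))

  coeff-∘ₚ-zero : ∀ a p s d → coeff ((a ∷ p) ∘ₚ affine s d) 0 ≈ a + s * coeff (p ∘ₚ affine s d) 0
  coeff-∘ₚ-zero a p s d = trans (coeff-+ₚ (const a) (affine s d *ₚ (p ∘ₚ affine s d)) 0)
    (+-congˡ (coeff-∷-*ₚ-zero s (d ∷ []) (p ∘ₚ affine s d)))

  coeff-∘ₚ-suc : ∀ a p s d n → coeff ((a ∷ p) ∘ₚ affine s d) (suc n)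
                 ≈ s * coeff (p ∘ₚ affine s d) (suc n) + d * coeff (p ∘ₚ affine s d) n
  coeff-∘ₚ-suc a p s d n = trans (coeff-+ₚ (const a) (affine s d *ₚ q) (suc n))
    (trans (+-identityˡ _) (trans (coeff-∷-*ₚ-suc s (d ∷ []) q n) (+-congˡ (coeff-const-*ₚ d q n))))
    where q = p ∘ₚ affine s d

  coeff-∘ₚ-affine : ∀ p s d n → coeff (p ∘ₚ affine s d) n ≈ d ^ n * coeff (p ∘ₚ affine s 1#) n
  coeff-∘ₚ-affine []      s d n       = sym (zeroʳ _)
  coeff-∘ₚ-affine (a ∷ p) s d zero    = begin
    coeff ((a ∷ p) ∘ₚ affine s d) 0      ≈⟨ coeff-∘ₚ-zero a p s d ⟩
    a + s * coeff (p ∘ₚ affine s d) 0    ≈⟨ +-congˡ (*-congˡ (trans (coeff-∘ₚ-affine p s d 0) (*-identityˡ _))) ⟩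
    a + s * coeff (p ∘ₚ affine s 1#) 0   ≈⟨ coeff-∘ₚ-zero a p s 1# ⟨
    coeff ((a ∷ p) ∘ₚ affine s 1#) 0     ≈⟨ *-identityˡ _ ⟨
    1# * coeff ((a ∷ p) ∘ₚ affine s 1#) 0 ∎
  coeff-∘ₚ-affine (a ∷ p) s d (suc n) = begin
    coeff ((a ∷ p) ∘ₚ affine s d) (suc n)
      ≈⟨ coeff-∘ₚ-suc a p s d n ⟩
    s * coeff (p ∘ₚ affine s d) (suc n) + d * coeff (p ∘ₚ affine s d) n
      ≈⟨ +-cong (*-congˡ (coeff-∘ₚ-affine p s d (suc n))) (*-congˡ (coeff-∘ₚ-affine p s d n)) ⟩
    s * (d ^ suc n * e₁) + d * (d ^ n * e₀)
      ≈⟨ +-cong (*-leftComm s (d ^ suc n) e₁) (sym (*-assoc d (d ^ n) e₀)) ⟩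
    d ^ suc n * (s * e₁) + d ^ suc n * e₀
      ≈⟨ +-congˡ (*-congˡ (*-identityˡ e₀)) ⟨
    d ^ suc n * (s * e₁) + d ^ suc n * (1# * e₀)
      ≈⟨ distribˡ (d ^ suc n) _ _ ⟨
    d ^ suc n * (s * e₁ + 1# * e₀)
      ≈⟨ *-congˡ (coeff-∘ₚ-suc a p s 1# n) ⟨
    d ^ suc n * coeff ((a ∷ p) ∘ₚ affine s 1#) (suc n) ∎
    where
    e₁ = coeff (p ∘ₚ affine s 1#) (suc n)
    e₀ = coeff (p ∘ₚ affine s 1#) n

  ∘ₚ-zero : ∀ p h → p ≈ₚ 0ₚ → (p ∘ₚ h) ≈ₚ 0ₚ
  ∘ₚ-zero []      h p≈0 = λ _ → refl
  ∘ₚ-zero (a ∷ p) h p≈0 =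
    coeff-≈ (+ₚ-cong {const a} {0ₚ} const-a≋0 (≋-trans (*ₚ-congˡ h p∘h≋0) (*ₚ-zeroʳ h)))
    where
    const-a≋0 : const a ≋ 0ₚ
    const-a≋0 = ≋-trans (∷-cong (p≈0 0) ≋-refl) 0∷0ₚ
    p∘h≋0 : (p ∘ₚ h) ≋ 0ₚ
    p∘h≋0 = coeffwise (∘ₚ-zero p h (λ i → p≈0 (suc i)))

  ∘ₚ-vanishes-suc : ∀ a p s d m → coeff (p ∘ₚ affine s d) (suc m) ≈ 0# → coeff (p ∘ₚ affine s d) m ≈ 0# →
                    coeff ((a ∷ p) ∘ₚ affine s d) (suc m) ≈ 0#
  ∘ₚ-vanishes-suc a p s d m q[m+1]≈0 q[m]≈0 = trans (coeff-∘ₚ-suc a p s d m)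
    (trans (+-cong (trans (*-congˡ q[m+1]≈0) (zeroʳ s)) (trans (*-congˡ q[m]≈0) (zeroʳ d))) (+-identityˡ 0#))

  translate-degree : ∀ p s n → DegreeAtMost p n →
                     DegreeAtMost (p ∘ₚ affine s 1#) n × coeff (p ∘ₚ affine s 1#) n ≈ coeff p n
  translate-degree []      s n       p≤n = (λ _ _ → refl) , refl
  translate-degree (a ∷ p) s zero    p≤0 = bound , top
    where
    p∘h≈0 = ∘ₚ-zero p (affine s 1#) (λ i → p≤0 (suc i) (s≤s z≤n))
    bound : DegreeAtMost ((a ∷ p) ∘ₚ affine s 1#) 0
    bound (suc m) _ = ∘ₚ-vanishes-suc a p s 1# m (p∘h≈0 (suc m)) (p∘h≈0 m)
    top = trans (coeff-∘ₚ-zero a p s 1#) (trans (+-congˡ (trans (*-congˡ (p∘h≈0 0)) (zeroʳ s))) (+-identityʳ a))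
  translate-degree (a ∷ p) s (suc n) p≤n = bound , top
    where
    IH = translate-degree p s n (λ m n<m → p≤n (suc m) (s≤s n<m))
    bound : DegreeAtMost ((a ∷ p) ∘ₚ affine s 1#) (suc n)
    bound (suc m) (s≤s n<m) =
      ∘ₚ-vanishes-suc a p s 1# m (proj₁ IH (suc m) (ℕ.m<n⇒m<1+n n<m)) (proj₁ IH m n<m)
    top = trans (coeff-∘ₚ-suc a p s 1# n)
      (trans (+-cong (trans (*-congˡ (proj₁ IH (suc n) (ℕ.n<1+n n))) (zeroʳ s)) (trans (*-identityˡ _) (proj₂ IH)))
             (+-identityˡ _))

module FiniteSums {c ℓ} (M : CommutativeMonoid c ℓ) where
  open CommutativeMonoid M renaming (_∙_ to _+_; ε to 0#; identityʳ to +-identityʳ)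
  open import Algebra.Properties.CommutativeMonoid.Sum M

  sum-zero : ∀ {n} (t : Fin n → Carrier) → (∀ k → t k ≈ 0#) → sum t ≈ 0#
  sum-zero {n} t t≈0 = trans (sum-cong-≋ t≈0) (sum-replicate-zero n)

  sum-single : ∀ {n} (t : Fin n → Carrier) i → (∀ k → k ≢ i → t k ≈ 0#) → sum t ≈ t i
  sum-single {suc n} t i t≈0 = trans (sum-remove t)
    (trans (∙-congˡ (sum-zero (removeAt t i) λ k → t≈0 (Fin.punchIn i k) (Fin.punchInᵢ≢i i k)))
           (+-identityʳ (t i)))

module Elimination {c ℓ} (R : CommutativeRing c ℓ) where
  open CommutativeRing R
  open import Algebra.Properties.Semiring.Sum semiring
  open import Algebra.Properties.Ring ring using (-‿distribˡ-*)
  open FiniteSums +-commutativeMonoid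
  open SetoidReasoning setoid

  module _ {L : ℕ} (a : Fin L → Carrier) where

    pivotProduct : (m : ℕ) → m ≤ L → Carrier
    pivotProduct zero    _   = 1#
    pivotProduct (suc m) m<L = pivotProduct m (ℕ.<⇒≤ m<L) * a (fromℕ< m<L)

    pivotProduct-nonzero : IsDomain R → (∀ j → ¬ a j ≈ 0#) → ∀ m (m≤L : m ≤ L) → ¬ pivotProduct m m≤L ≈ 0#
    pivotProduct-nonzero domain a≉0 zero    _   = IsDomain.1≉0 domain
    pivotProduct-nonzero domain a≉0 (suc m) m<L =
      IsDomain.noZeroDivisors domain (pivotProduct-nonzero domain a≉0 m (ℕ.<⇒≤ m<L)) (a≉0 (fromℕ< m<L))

    -- e k x is the entry at position x of the k-th vector, π j the pivot position of the j-th,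
    -- and a row r stands for the combination Σ_k r k (e k).
    module _ {X : Set} (e : Fin L → X → Carrier) (π : Fin L → X) where

      Row : Set c
      Row = Fin L → Carrier

      combination : Row → X → Carrier
      combination r x = ∑[ k < L ] (r k * e k x)

      unit : Fin L → Row
      unit j k with k Fin.≟ j
      ... | yes _ = 1#
      ... | no  _ = 0#

      pivotWeight : Fin L → Fin L → Row → Carrier
      pivotWeight i j r with toℕ j ℕ.<? toℕ i
      ... | yes _ = - combination r (π j)
      ... | no  _ = 0#

      clear : Fin L → Fin L → Row → Row
      clear i j r k = a j * r k + pivotWeight i j r * unit j k

      clearBelow : Fin L → (m : ℕ) → m ≤ L → Row → Row
      clearBelow i zero    _   r = r
      clearBelow i (suc m) m<L r = clearBelow i m (ℕ.<⇒≤ m<L) (clear i (fromℕ< m<L) r)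

      rows : Fin L → Row
      rows i = clearBelow i L ℕ.≤-refl (unit i)

      unit-diagonal : ∀ j → unit j j ≈ 1#
      unit-diagonal j with j Fin.≟ j
      ... | yes _   = refl
      ... | no j≢j = contradiction ≡.refl j≢j

      unit-offDiagonal : ∀ {j k} → k ≢ j → unit j k ≈ 0#
      unit-offDiagonal {j} {k} k≢j with k Fin.≟ j
      ... | yes k≡j = contradiction k≡j k≢j
      ... | no  _   = refl

      combination-unit : ∀ j x → combination (unit j) x ≈ e j x
      combination-unit j x = begin
        ∑[ k < L ] (unit j k * e k x)
          ≈⟨ sum-single _ j (λ k k≢j → trans (*-congʳ (unit-offDiagonal k≢j)) (zeroˡ _)) ⟩
        unit j j * e j x
          ≈⟨ trans (*-congʳ (unit-diagonal j)) (*-identityˡ _) ⟩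
        e j x ∎

      combination-linear : ∀ α β r r' x →
        combination (λ k → α * r k + β * r' k) x ≈ α * combination r x + β * combination r' x
      combination-linear α β r r' x = begin
        ∑[ k < L ] ((α * r k + β * r' k) * e k x)
          ≈⟨ sum-cong-≋ (λ k → trans (distribʳ (e k x) (α * r k) (β * r' k))
                                     (+-cong (*-assoc α (r k) (e k x)) (*-assoc β (r' k) (e k x)))) ⟩
        ∑[ k < L ] (α * (r k * e k x) + β * (r' k * e k x))
          ≈⟨ ∑-distrib-+ (λ k → α * (r k * e k x)) (λ k → β * (r' k * e k x)) ⟩
        ∑[ k < L ] (α * (r k * e k x)) + ∑[ k < L ] (β * (r' k * e k x))
          ≈⟨ +-cong (*-distribˡ-sum α (λ k → r k * e k x)) (*-distribˡ-sum β (λ k → r' k * e k x)) ⟨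
        α * combination r x + β * combination r' x ∎

      combination-clear : ∀ i j r x →
        combination (clear i j r) x ≈ a j * combination r x + pivotWeight i j r * e j x
      combination-clear i j r x =
        trans (combination-linear (a j) (pivotWeight i j r) r (unit j) x) (+-congˡ (*-congˡ (combination-unit j x)))

      clear-preserves-zero : ∀ i j r {x} → combination r x ≈ 0# → e j x ≈ 0# → combination (clear i j r) x ≈ 0#
      clear-preserves-zero i j r r≈0 e≈0 = trans (combination-clear i j r _)
        (trans (+-cong (trans (*-congˡ r≈0) (zeroʳ _)) (trans (*-congˡ e≈0) (zeroʳ _))) (+-identityʳ 0#))

      pivotWeight-below : ∀ {i j} r → toℕ j < toℕ i → pivotWeight i j r ≈ - combination r (π j)
      pivotWeight-below {i} {j} r j<i with toℕ j ℕ.<? toℕ i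
      ... | yes _   = refl
      ... | no j≮i = contradiction j<i j≮i

      pivotWeight-notBelow : ∀ {i j} r → ¬ toℕ j < toℕ i → pivotWeight i j r ≈ 0#
      pivotWeight-notBelow {i} {j} r j≮i with toℕ j ℕ.<? toℕ i
      ... | yes j<i = contradiction j<i j≮i
      ... | no  _   = refl

      clear-entry : ∀ i j r k → toℕ i ≤ toℕ k → clear i j r k ≈ a j * r k
      clear-entry i j r k i≤k = trans (+-congˡ (correction≈0 (toℕ j ℕ.<? toℕ i))) (+-identityʳ _)
        where
        correction≈0 : Dec (toℕ j < toℕ i) → pivotWeight i j r * unit j k ≈ 0#
        correction≈0 (yes j<i) = trans (*-congˡ (unit-offDiagonal k≢j)) (zeroʳ _)
          where k≢j = λ k≡j → ℕ.<⇒≱ j<i (≡.subst (λ k → toℕ i ≤ toℕ k) k≡j i≤k)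
        correction≈0 (no j≮i)  = trans (*-congʳ (pivotWeight-notBelow r j≮i)) (zeroˡ _)

      clearBelow-entry : ∀ i m (m≤L : m ≤ L) r k → toℕ i ≤ toℕ k →
                         clearBelow i m m≤L r k ≈ pivotProduct m m≤L * r k
      clearBelow-entry i zero    _   r k i≤k = sym (*-identityˡ _)
      clearBelow-entry i (suc m) m<L r k i≤k = begin
        clearBelow i m _ (clear i j r) k       ≈⟨ clearBelow-entry i m _ (clear i j r) k i≤k ⟩
        pivotProduct m _ * clear i j r k       ≈⟨ *-congˡ (clear-entry i j r k i≤k) ⟩
        pivotProduct m _ * (a j * r k)         ≈⟨ *-assoc _ _ _ ⟨
        pivotProduct m _ * a j * r k           ∎
        where j = fromℕ< m<L

      rows-upper : ∀ {i k} → toℕ i < toℕ k → rows i k ≈ 0#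
      rows-upper {i} {k} i<k = trans (clearBelow-entry i L ℕ.≤-refl (unit i) k (ℕ.<⇒≤ i<k))
        (trans (*-congˡ (unit-offDiagonal λ k≡i → ℕ.<-irrefl (≡.cong toℕ (≡.sym k≡i)) i<k)) (zeroʳ _))

      rows-diagonal : ∀ i → rows i i ≈ pivotProduct L ℕ.≤-refl
      rows-diagonal i = trans (clearBelow-entry i L ℕ.≤-refl (unit i) i ℕ.≤-refl)
        (trans (*-congˡ (unit-diagonal i)) (*-identityʳ _))

      module _ (e-below : ∀ {k j} → toℕ k < toℕ j → e k (π j) ≈ 0#)
               (pivot : ∀ j → e j (π j) ≈ a j ⊎ (∀ k → e k (π j) ≈ 0#)) where

        clear-clears : ∀ i j r → toℕ j < toℕ i → combination (clear i j r) (π j) ≈ 0#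
        clear-clears i j r j<i = begin
          combination (clear i j r) (π j)           ≈⟨ combination-clear i j r (π j) ⟩
          a j * C + pivotWeight i j r * e j (π j)   ≈⟨ +-congˡ (*-congʳ (pivotWeight-below r j<i)) ⟩
          a j * C + - C * e j (π j)                 ≈⟨ cancel (pivot j) ⟩
          0#                                        ∎
          where
          C = combination r (π j)
          cancel : e j (π j) ≈ a j ⊎ (∀ k → e k (π j) ≈ 0#) → a j * C + - C * e j (π j) ≈ 0#
          cancel (inj₁ e≈a) = trans (+-congˡ -C*e≈-[a*C]) (-‿inverseʳ _)
            where
            -C*e≈-[a*C] = trans (*-congˡ e≈a) (trans (sym (-‿distribˡ-* C (a j))) (-‿cong (*-comm C (a j))))
          cancel (inj₂ e≈0) =
            trans (+-cong (trans (*-congˡ C≈0) (zeroʳ _)) (trans (*-congˡ (e≈0 j)) (zeroʳ _))) (+-identityʳ 0#)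
            where C≈0 = sum-zero _ λ k → trans (*-congˡ (e≈0 k)) (zeroʳ _)

        clearBelow-clears : ∀ i m (m≤L : m ≤ L) r →
          (∀ j → m ≤ toℕ j → toℕ j < toℕ i → combination r (π j) ≈ 0#) →
          ∀ j → toℕ j < toℕ i → combination (clearBelow i m m≤L r) (π j) ≈ 0#
        clearBelow-clears i zero    _   r cleared = λ j → cleared j z≤n
        clearBelow-clears i (suc m) m<L r cleared = clearBelow-clears i m _ (clear i jₘ r) cleared′
          where
          jₘ = fromℕ< m<L
          cleared′ : ∀ j → m ≤ toℕ j → toℕ j < toℕ i → combination (clear i jₘ r) (π j) ≈ 0#
          cleared′ j m≤j j<i with ℕ.m≤n⇒m<n∨m≡n m≤j
          ... | inj₁ m<j = clear-preserves-zero i jₘ r (cleared j m<j j<i)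
                             (e-below (≡.subst (_< toℕ j) (≡.sym (Fin.toℕ-fromℕ< m<L)) m<j))
          ... | inj₂ m≡j = ≡.subst (λ j′ → combination (clear i j′ r) (π j) ≈ 0#)
                             (≡.sym (Fin.toℕ-injective (≡.trans (Fin.toℕ-fromℕ< m<L) m≡j)))
                             (clear-clears i j r j<i)

        rows-clear : ∀ {i j} → toℕ j < toℕ i → combination (rows i) (π j) ≈ 0#
        rows-clear {i} {j} = clearBelow-clears i L ℕ.≤-refl (unit i)
          (λ j L≤j _ → contradiction (Fin.toℕ<n j) (ℕ.≤⇒≯ L≤j)) j

≮ᵐnothing : ∀ x → ¬ x <ᵐ nothing
≮ᵐnothing nothing  ()
≮ᵐnothing (just _) ()

<ᵐ-trans : ∀ {x y z} → x <ᵐ y → y <ᵐ z → x <ᵐ z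
<ᵐ-trans {nothing} {just _} {just _} _   _   = tt
<ᵐ-trans {just _}  {just _} {just _} x<y y<z = ℕ.<-trans x<y y<z

module LeadingCoefficientSeparation
  (R : CommutativeRing 0ℓ 0ℓ) (domain : IsDomain R) {L : ℕ}
  (f : Fin L → Poly.P (CommutativeRing.rawRing R)) (δ : Fin L → Maybe ℕ)
  (hasDeg : ∀ j → Poly.HasDeg (CommutativeRing.rawRing R) (f j) (δ j))
  (δ-increasing : ∀ i j → toℕ i < toℕ j → δ i <ᵐ δ j)
  where

  open CommutativeRing R
  open IsDomain domain
  open Poly rawRing renaming (rawRing to rawRingₚ)
  open RingHelpers rawRing using (_^_; _^ᵐ_)
  open RingHelpers rawRingₚ using (sumFin)
  open import Algebra.Properties.Semiring.Sum semiring
  open import Algebra.Properties.CommutativeSemigroup *-commutativeSemigroup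
    using () renaming (x∙yz≈y∙xz to *-leftComm)
  open FiniteSums +-commutativeMonoid
  open PolynomialRing R using (coeff-sumFin)
  open PolynomialDegree R using (leadingCoeff; coeffᵐ≈leadingCoeff)
  open PolynomialsOverDomain R domain
  open AffineSubstitution R
  open Elimination R
  open SetoidReasoning setoid

  lc : Fin L → Carrier
  lc j = leadingCoeff (f j) (δ j)

  c : Carrier
  c = pivotProduct lc L ℕ.≤-refl

  c-nonzero : ¬ c ≈ 0#
  c-nonzero = pivotProduct-nonzero lc domain (λ j → leadingCoeff-nonzero (δ j) (hasDeg j)) L ℕ.≤-refl

  module _ (s : Carrier) where

    e : Fin L → Maybe ℕ → Carrier
    e k = coeffᵐ (f k ∘ₚ affine s 1#)

    e-above : ∀ k {x} → δ k <ᵐ x → e k x ≈ 0#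
    e-above k {nothing} δk<-∞ = contradiction δk<-∞ (≮ᵐnothing (δ k))
    e-above k {just m} δk<m with δ k | hasDeg k
    ... | nothing | f≈0       = ∘ₚ-zero (f k) (affine s 1#) f≈0 m
    ... | just n  | (_ , f≤n) = proj₁ (translate-degree (f k) s n f≤n) m δk<m

    e-leading : ∀ j → e j (δ j) ≈ coeffᵐ (f j) (δ j)
    e-leading j with δ j | hasDeg j
    ... | nothing | _         = refl
    ... | just n  | (_ , f≤n) = proj₂ (translate-degree (f j) s n f≤n)

    e-below : ∀ {k j} → toℕ k < toℕ j → e k (δ j) ≈ 0#
    e-below {k} {j} k<j = e-above k (δ-increasing k j k<j)

    e-pivot : ∀ j → e j (δ j) ≈ lc j ⊎ (∀ k → e k (δ j) ≈ 0#)
    e-pivot j with coeffᵐ≈leadingCoeff (f j) (δ j)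
    ... | inj₁ f[δ]≈lc = inj₁ (trans (e-leading j) f[δ]≈lc)
    ... | inj₂ δ≡-∞    = inj₂ λ k → ≡.subst (λ x → e k x ≈ 0#) (≡.sym δ≡-∞) refl

    A : Fin L → Fin L → Carrier
    A = rows lc e δ

    A-upper : ∀ i j → toℕ i < toℕ j → A i j ≈ 0#
    A-upper i j = rows-upper lc e δ

    A-diagonal : ∀ i → A i i ≈ c
    A-diagonal = rows-diagonal lc e δ

    combination-above : ∀ i {x} → δ i <ᵐ x → combination lc e δ (A i) x ≈ 0#
    combination-above i {x} δi<x = sum-zero _ term≈0
      where
      term≈0 : ∀ k → A i k * e k x ≈ 0#
      term≈0 k with ℕ.<-cmp (toℕ i) (toℕ k)
      ... | tri< i<k _ _ = trans (*-congʳ (A-upper i k i<k)) (zeroˡ _)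
      ... | tri≈ _ i≡k _ =
        trans (*-congˡ (e-above k (≡.subst (λ k → δ k <ᵐ x) (Fin.toℕ-injective i≡k) δi<x))) (zeroʳ _)
      ... | tri> _ _ k<i = trans (*-congˡ (e-above k (<ᵐ-trans (δ-increasing k i k<i) δi<x))) (zeroʳ _)

    combination-diagonal : ∀ i → combination lc e δ (A i) (δ i) ≈ c * coeffᵐ (f i) (δ i)
    combination-diagonal i = begin
      ∑[ k < L ] (A i k * e k (δ i)) ≈⟨ sum-single _ i term≈0 ⟩
      A i i * e i (δ i)              ≈⟨ *-cong (A-diagonal i) (e-leading i) ⟩
      c * coeffᵐ (f i) (δ i)         ∎
      where
      term≈0 : ∀ k → k ≢ i → A i k * e k (δ i) ≈ 0#
      term≈0 k k≢i with ℕ.<-cmp (toℕ k) (toℕ i)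
      ... | tri< k<i _ _ = trans (*-congˡ (e-below k<i)) (zeroʳ _)
      ... | tri≈ _ k≡i _ = contradiction (Fin.toℕ-injective k≡i) k≢i
      ... | tri> _ _ i<k = trans (*-congʳ (A-upper i k i<k)) (zeroˡ _)

    combination-offDiagonal : ∀ i j → i ≢ j → combination lc e δ (A i) (δ j) ≈ 0#
    combination-offDiagonal i j i≢j with ℕ.<-cmp (toℕ i) (toℕ j)
    ... | tri< i<j _ _ = combination-above i (δ-increasing i j i<j)
    ... | tri≈ _ i≡j _ = contradiction (Fin.toℕ-injective i≡j) i≢j
    ... | tri> _ _ j<i = rows-clear lc e δ e-below e-pivot j<i

    module _ (d : Carrier) where

      g : Fin L → P
      g i = sumFin L (λ k → const (A i k) *ₚ (f k ∘ₚ affine s d))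

      coeff-g : ∀ i n → coeff (g i) n ≈ d ^ n * combination lc e δ (A i) (just n)
      coeff-g i n = begin
        coeff (g i) n
          ≈⟨ coeff-sumFin L (λ k → const (A i k) *ₚ (f k ∘ₚ affine s d)) n ⟩
        ∑[ k < L ] coeff (const (A i k) *ₚ (f k ∘ₚ affine s d)) n
          ≈⟨ sum-cong-≋ term ⟩
        ∑[ k < L ] (d ^ n * (A i k * e k (just n)))
          ≈⟨ *-distribˡ-sum (d ^ n) (λ k → A i k * e k (just n)) ⟨
        d ^ n * combination lc e δ (A i) (just n) ∎
        where
        term : ∀ k → coeff (const (A i k) *ₚ (f k ∘ₚ affine s d)) n ≈ d ^ n * (A i k * e k (just n))
        term k = trans (coeff-const-*ₚ (A i k) (f k ∘ₚ affine s d) n)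
          (trans (*-congˡ (coeff-∘ₚ-affine (f k) s d n)) (*-leftComm (A i k) (d ^ n) _))

      coeffᵐ-g : ∀ i x → coeffᵐ (g i) x ≈ d ^ᵐ x * combination lc e δ (A i) x
      coeffᵐ-g i nothing  = sym (trans (*-identityˡ _) (sum-zero _ λ k → zeroʳ (A i k)))
      coeffᵐ-g i (just n) = coeff-g i n

      g-offDiagonal : ∀ i j → i ≢ j → coeffᵐ (g i) (δ j) ≈ 0#
      g-offDiagonal i j i≢j =
        trans (coeffᵐ-g i (δ j)) (trans (*-congˡ (combination-offDiagonal i j i≢j)) (zeroʳ _))

      g-leading : ∀ j → coeffᵐ (g j) (δ j) ≈ c * (d ^ᵐ δ j * coeffᵐ (f j) (δ j))
      g-leading j = trans (coeffᵐ-g j (δ j)) (trans (*-congˡ (combination-diagonal j)) (*-leftComm _ c _))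

      g-hasDeg : ¬ d ≈ 0# → ∀ j → HasDeg (g j) (δ j)
      g-hasDeg d≉0 j = hasDeg-fromLeading (δ j) (hasDeg j)
        (noZeroDivisors c-nonzero (^ᵐ-nonzero (δ j) d≉0))
        (trans (g-leading j) (sym (*-assoc _ _ _)))
        (λ m δj<m → trans (coeff-g j m) (trans (*-congˡ (combination-above j δj<m)) (zeroʳ _)))

field-isDomain : (F : FiniteField) → IsDomain (FiniteField.commutativeRing F)
field-isDomain F = record
  { 1≉0            = λ 1≈0 → 0≉1 (sym 1≈0)
  ; noZeroDivisors = λ {x} {y} x≉0 y≉0 xy≈0 → y≉0 (begin
      y                  ≈⟨ *-identityˡ y ⟨
      1# * y             ≈⟨ *-congʳ (trans (*-comm (x ⁻¹) x) (inverseʳ x x≉0)) ⟨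
      (x ⁻¹ * x) * y     ≈⟨ *-assoc _ _ _ ⟩
      x ⁻¹ * (x * y)     ≈⟨ *-congˡ xy≈0 ⟩
      x ⁻¹ * 0#          ≈⟨ zeroʳ _ ⟩
      0#                 ∎)
  }
  where
  open FiniteField F
  open SetoidReasoning setoid

lemma3p1 : (F : FiniteField) → let open Rings F in
    (L : ℕ) (f : Fin L → Pu.P) (δ : Fin L → Maybe ℕ) →
    (∀ j → Pu.HasDeg (f j) (δ j)) →
    (∀ i j → toℕ i < toℕ j → δ i <ᵐ δ j) →
    Σ Pt.P λ c →
    (s : Pt.P) →
    Σ (Fin L → Fin L → Pt.P) λ A →
      (∀ i j → toℕ i < toℕ j → A i j Pt.≈ₚ Pt.0ₚ) ×
      (∀ i → A i i Pt.≈ₚ c) ×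
      ((d : Pt.P) → ¬ (d Pt.≈ₚ Pt.0ₚ) →
        Σ (Fin L → Pu.P) λ g →
          (∀ i → HB.sumFin L (λ j → Pu.const (A i j) Pu.*ₚ (f j Pu.∘ₚ (s ∷ d ∷ []))) Pu.≈ₚ g i) ×
          (∀ j → Pu.HasDeg (g j) (δ j)) ×
          (∀ i j → ¬ (i ≡ j) → Pu.coeffᵐ (g i) (δ j) Pt.≈ₚ Pt.0ₚ) ×
          (∀ j → Pu.coeffᵐ (g j) (δ j) Pt.≈ₚ (c Pt.*ₚ ((d HA.^ᵐ δ j) Pt.*ₚ Pu.coeffᵐ (f j) (δ j)))))
lemma3p1 F L f δ hasDeg δ-increasing =
  c , λ s → A s , A-upper s , A-diagonal s ,
    λ d d≉0 → g s d , (λ _ _ _ → FiniteField.refl F) , g-hasDeg s d d≉0 , g-offDiagonal s d , g-leading s d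
  where
  open FiniteField F using (commutativeRing; _≟_)
  𝔽[t] = PolynomialRing.commutativeRing commutativeRing
  𝔽[t]-isDomain = PolynomialDegree.isDomain commutativeRing _≟_ (field-isDomain F)
  open LeadingCoefficientSeparation 𝔽[t] 𝔽[t]-isDomain f δ hasDeg δ-increasing
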